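{- Let $i\ge0$ be an integer, let $G$ be an $\alpha_i$-metric graph, and let $D(u,r_u),D(v,r_v),D(w,r_w)$ be pairwise intersecting disks of $G$. Then there exists a vertex $x$ such that $d(u,x)\le r_u$, $d(v,x)\le r_v$ and $d(w,x)\le r_w+i$.
   Context: All graphs are finite, undirected, unweighted, simple and connected; $d$ is the shortest-path distance, $I(u,v)=\{z : d(u,v)=d(u,z)+d(z,v)\}$, and $D(v,r)=\{z : d(v,z)\le r\}$ is the disk of center $v$ and radius $r$ (a nonnegative integer). A graph is $\alpha_i$-metric if for all vertices $u,v,w,x$ with $v\in I(u,w)$, $w\in I(v,x)$ and $v,w$ adjacent, $d(u,x)\ge d(u,v)+d(v,x)-i$. -}

module Defs where

open import Data.Nat using (ℕ; zero; suc; _+_; _≤_)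
open import Data.Fin using (Fin)
open import Data.Product using (Σ; ∃; _×_; _,_)
open import Relation.Nullary using (¬_; Dec)
open import Relation.Binary.PropositionalEquality using (_≡_)

data Walk {n : ℕ} (Adj : Fin n → Fin n → Set) : Fin n → Fin n → ℕ → Set where
  here : ∀ {u} → Walk Adj u u zero
  step : ∀ {u v w k} → Adj u v → Walk Adj v w k → Walk Adj u w (suc k)

record Graph : Set₁ where
  field
    n      : ℕ
    Adj    : Fin n → Fin n → Set
    adj?   : ∀ u v → Dec (Adj u v)
    sym    : ∀ {u v} → Adj u v → Adj v u
    irrefl : ∀ {u} → ¬ Adj u u
    connected : ∀ u v → ∃ λ k → Walk Adj u v k

  Vertex : Set
  Vertex = Fin n

open Graph public

IsShortest : (G : Graph) → Vertex G → Vertex G → ℕ → Set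
IsShortest G u v k = Walk (Adj G) u v k × (∀ m → Walk (Adj G) u v m → k ≤ m)

-- d is the shortest-path distance function of G
-- (such a function exists by connectivity and is unique).
IsDistance : (G : Graph) → (Vertex G → Vertex G → ℕ) → Set
IsDistance G d = ∀ u v → IsShortest G u v (d u v)

InInterval : (G : Graph) → (Vertex G → Vertex G → ℕ) → Vertex G → Vertex G → Vertex G → Set
InInterval G d z u v = d u v ≡ d u z + d z v

InDisk : (G : Graph) → (Vertex G → Vertex G → ℕ) → Vertex G → Vertex G → ℕ → Set
InDisk G d z v r = d v z ≤ r

-- α_i-metric: for all u,v,w,x with v ∈ I(u,w), w ∈ I(v,x), v ~ w,
-- d(u,x) ≥ d(u,v) + d(v,x) - i   (stated over ℕ as d(u,v)+d(v,x) ≤ d(u,x)+i)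
AlphaMetric : (i : ℕ) (G : Graph) → (Vertex G → Vertex G → ℕ) → Set
AlphaMetric i G d = ∀ u v w x → InInterval G d v u w → InInterval G d w v x → Adj G v w →
  d u v + d v x ≤ d u x + i

{-# OPTIONS --safe #-}
module Submission where

-- Start at a vertex x of D(u,r_u) ∩ D(v,r_v) and follow a shortest path from x
-- to w for as long as both disks are kept. If w is reached we are done.
-- Otherwise the next vertex y leaves, say, D(u,r_u); then d(u,x) = r_u and
-- d(u,y) = r_u + 1, so x ∈ I(u,y) and y ∈ I(x,w), and the α_i-metric inequality
-- gives r_u + d(x,w) ≤ d(u,w) + i ≤ r_u + r_w + i.

open import Defs hiding (sym)
open import Data.Fin using (Fin)
open import Data.Nat using (ℕ; zero; suc; _+_; _≤_; _<_; _≤?_; z≤n; s≤s)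
open import Data.Nat.Properties
open import Data.Product using (∃; _×_; _,_; proj₁; proj₂)
open import Data.Empty using (⊥-elim)
open import Relation.Nullary using (yes; no)
open import Relation.Binary.PropositionalEquality
  using (_≡_; refl; sym; trans; cong; cong₂; subst)

module _ {n : ℕ} {Adj : Fin n → Fin n → Set} where

  _++_ : ∀ {a b c k m} → Walk Adj a b k → Walk Adj b c m → Walk Adj a c (k + m)
  here     ++ q = q
  step e p ++ q = step e (p ++ q)

  snoc : ∀ {a b c k} → Walk Adj a b k → Adj b c → Walk Adj a c (suc k)
  snoc here       e = step e here
  snoc (step f p) e = step f (snoc p e)

  reverse : (∀ {a b} → Adj a b → Adj b a) →
            ∀ {a b k} → Walk Adj a b k → Walk Adj b a k
  reverse adj-sym here       = here
  reverse adj-sym (step e p) = snoc (reverse adj-sym p) (adj-sym e)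

module Distance (G : Graph) (d : Vertex G → Vertex G → ℕ) (d-shortest : IsDistance G d) where

  shortest-walk : ∀ a b → Walk (Adj G) a b (d a b)
  shortest-walk a b = proj₁ (d-shortest a b)

  d-minimal : ∀ {a b k} → Walk (Adj G) a b k → d a b ≤ k
  d-minimal = proj₂ (d-shortest _ _) _

  d-triangle : ∀ a b c → d a c ≤ d a b + d b c
  d-triangle a b c = d-minimal (shortest-walk a b ++ shortest-walk b c)

  d-sym : ∀ a b → d a b ≡ d b a
  d-sym a b = ≤-antisym (d-minimal (reverse (Graph.sym G) (shortest-walk b a)))
                        (d-minimal (reverse (Graph.sym G) (shortest-walk a b)))

  d-adj : ∀ {a b} → Adj G a b → d a b ≡ 1
  d-adj {a} {b} e with d a b | shortest-walk a b | d-minimal (step e here)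
  ... | zero        | here | _       = ⊥-elim (irrefl G e)
  ... | suc zero    | _    | _       = refl
  ... | suc (suc _) | _    | s≤s ()

  d-adj-step : ∀ c {a b} → Adj G a b → d c b ≤ suc (d c a)
  d-adj-step c {a} {b} e = begin
    d c b         ≤⟨ d-triangle c a b ⟩
    d c a + d a b ≡⟨ cong (d c a +_) (d-adj e) ⟩
    d c a + 1     ≡⟨ +-comm (d c a) 1 ⟩
    suc (d c a)   ∎
    where open ≤-Reasoning

  geodesic-step : ∀ x w {k} → d x w ≡ suc k → ∃ λ y → Adj G x y × d y w ≡ k
  geodesic-step x w {k} xw with subst (Walk (Adj G) x w) xw (shortest-walk x w)
  ... | step {v = y} e p = y , e , ≤-antisym (d-minimal p) (≤-pred 1+k≤1+yw)
    where
    open ≤-Reasoning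
    1+k≤1+yw : suc k ≤ suc (d y w)
    1+k≤1+yw = begin
      suc k         ≡⟨ sym xw ⟩
      d x w         ≤⟨ d-triangle x y w ⟩
      d x y + d y w ≡⟨ cong (_+ d y w) (d-adj e) ⟩
      suc (d y w)   ∎

  leaving-disk : ∀ {u x y r} → d u x ≤ r → r < d u y → Adj G x y →
                 d u x ≡ r × d u y ≡ suc r
  leaving-disk {u} ux≤r r<uy e =
    ≤-antisym ux≤r (≤-pred (≤-trans r<uy (d-adj-step u e))) ,
    ≤-antisym (≤-trans (d-adj-step u e) (s≤s ux≤r)) r<uy

  intersecting-disks : ∀ {u w z r s} → InDisk G d z u r → InDisk G d z w s → d u w ≤ r + s
  intersecting-disks {u} {w} {z} {r} {s} uz wz =
    ≤-trans (d-triangle u z w) (+-mono-≤ uz (subst (_≤ s) (d-sym w z) wz))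

module AlphaMetricDistance (i : ℕ) (G : Graph) (d : Vertex G → Vertex G → ℕ)
                           (d-shortest : IsDistance G d) (α : AlphaMetric i G d) where

  open Distance G d d-shortest

  leaving-disk-bound : ∀ {u w x y r s} → d u w ≤ r + s → d u x ≤ r → r < d u y →
                       Adj G x y → d x w ≡ suc (d y w) → d w x ≤ s + i
  leaving-disk-bound {u} {w} {x} {y} {r} {s} uw ux r<uy e xw =
    subst (_≤ s + i) (d-sym x w) (+-cancelˡ-≤ r _ _ r+xw≤r+s+i)
    where
    open ≤-Reasoning
    ux≡r : d u x ≡ r
    ux≡r = proj₁ (leaving-disk ux r<uy e)
    uy≡1+r : d u y ≡ suc r
    uy≡1+r = proj₂ (leaving-disk ux r<uy e)
    x∈I[u,y] : d u y ≡ d u x + d x y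
    x∈I[u,y] = begin-equality
      d u y         ≡⟨ uy≡1+r ⟩
      suc r         ≡⟨ +-comm 1 r ⟩
      r + 1         ≡⟨ sym (cong₂ _+_ ux≡r (d-adj e)) ⟩
      d u x + d x y ∎
    y∈I[x,w] : d x w ≡ d x y + d y w
    y∈I[x,w] = trans xw (cong (_+ d y w) (sym (d-adj e)))
    r+xw≤r+s+i : r + d x w ≤ r + (s + i)
    r+xw≤r+s+i = begin
      r + d x w     ≡⟨ cong (_+ d x w) (sym ux≡r) ⟩
      d u x + d x w ≤⟨ α u x y w x∈I[u,y] y∈I[x,w] e ⟩
      d u w + i     ≤⟨ +-monoˡ-≤ i uw ⟩
      r + s + i     ≡⟨ +-assoc r s i ⟩
      r + (s + i)   ∎

  descend : ∀ {u v w ru rv rw} → d u w ≤ ru + rw → d v w ≤ rv + rw →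
            ∀ {k} x → d x w ≡ k → InDisk G d x u ru → InDisk G d x v rv →
            ∃ λ x → InDisk G d x u ru × InDisk G d x v rv × InDisk G d x w (rw + i)
  descend {w = w} {rw = rw} uw vw {zero} x xw ux vx =
    x , ux , vx , subst (_≤ rw + i) (sym (trans (d-sym w x) xw)) z≤n
  descend {u} {v} {w} {ru} {rv} uw vw {suc k} x xw ux vx
    with geodesic-step x w xw
  ... | y , e , yw with d u y ≤? ru | d v y ≤? rv
  ...   | yes uy   | yes vy   = descend uw vw y yw uy vy
  ...   | no uy≰ru | _        =
    x , ux , vx , leaving-disk-bound uw ux (≰⇒> uy≰ru) e (trans xw (cong suc (sym yw)))
  ...   | yes _    | no vy≰rv =
    x , ux , vx , leaving-disk-bound vw vx (≰⇒> vy≰rv) e (trans xw (cong suc (sym yw)))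

lemma1 : (i : ℕ) (G : Graph) (d : Vertex G → Vertex G → ℕ) → IsDistance G d →
    AlphaMetric i G d →
    (u v w : Vertex G) (ru rv rw : ℕ) →
    (∃ λ z → InDisk G d z u ru × InDisk G d z v rv) →
    (∃ λ z → InDisk G d z u ru × InDisk G d z w rw) →
    (∃ λ z → InDisk G d z v rv × InDisk G d z w rw) →
    ∃ λ x → InDisk G d x u ru × InDisk G d x v rv × InDisk G d x w (rw + i)
lemma1 i G d d-shortest α u v w ru rv rw (x , xu , xv) (_ , zu , zw) (_ , z′v , z′w) =
  descend (intersecting-disks zu zw) (intersecting-disks z′v z′w) x refl xu xv
  where
  open Distance G d d-shortest
  open AlphaMetricDistance i G d d-shortest α
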